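{- Let $m$ be a positive integer, and let $n=8m+3$ and $m_1=2m+1$ (i.e., in binary, $n$ is the expansion of $m$ followed by $011$, and $m_1$ is the expansion of $m$ followed by $1$). Then \[ |H_8^{\nabla n}|=|H_8^{\nabla m_1}|+40\cdot|H_8^{\nabla m}|. \]
   Context: For nonempty finite sets $C=\{c_1,\ldots,c_s\}$, $D$ of positive integers, $C\mathbin{\nabla}D=c_1D\mathbin{\triangle}\cdots\mathbin{\triangle}c_sD$, where $c_iD=\{c_id:d\in D\}$ and $\triangle$ is symmetric difference. Let $H_8=\{1,2,\ldots,8\}$, $H_8^{\nabla0}=\{1\}$ and $H_8^{\nabla k}=H_8^{\nabla(k-1)}\mathbin{\nabla}H_8$ for $k\geq1$. -}

module Defs where

open import Data.Nat using (ℕ; zero; suc; _*_)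
open import Data.Nat.Properties using (_≟_)
open import Data.List using (List; []; _∷_; map; filter; _++_; foldr; length; upTo)
open import Data.List.Membership.DecPropositional _≟_ using (_∈?_; _∉?_)

-- Finite sets of positive integers are represented by duplicate-free lists
-- (all lists built below are duplicate-free); cardinality is the length.

_△_ : List ℕ → List ℕ → List ℕ
A △ B = filter (_∉? B) A ++ filter (_∉? A) B

infixl 6 _△_

scale : ℕ → List ℕ → List ℕ
scale c D = map (c *_) D

_∇_ : List ℕ → List ℕ → List ℕ
C ∇ D = foldr (λ c acc → scale c D △ acc) [] C

H8 : List ℕ
H8 = map suc (upTo 8)

H8pow : ℕ → List ℕ
H8pow zero = 1 ∷ []
H8pow (suc k) = H8pow k ∇ H8

card : ℕ → ℕ
card k = length (H8pow k)

-- In the group algebra 𝔽₂[ℕ] a finite set is a sum of basis elements, △ is addition and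
-- C ∇ D is the product C · D, so H₈^{∇k} is the k-th power of H₈; in characteristic 2,
-- squaring raises every element to its square.  With P = H₈^m this gives
--   H₈^{em+k} = P⁽ᵉ⁾ · H₈^k,   where P⁽ᵉ⁾ = {yᵉ : y ∈ P},
-- for (e, k) = (8, 3) and (2, 1).  Write H₈^k = S + {1, 2ᵉ} · {1, 2}; since
-- P⁽ᵉ⁾ · {1, 2ᵉ} = (P · {1, 2})⁽ᵉ⁾, with Q = P · {1, 2} we get
--   H₈^{em+k} = P⁽ᵉ⁾ · S + Q⁽ᵉ⁾ · {1, 2}.
-- Nothing cancels on the right: if yᵉ q = zᵉ q′ with 0 < q, q′ < 3ᵉ, then after dividing
-- by gcd(y, z)ᵉ the coprime bases have e-th powers dividing q′ and q, so they lie in {1, 2},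
-- which forces y = z and q = q′ unless q = 2ᵉ q′ or q′ = 2ᵉ q.  Hence
-- |H₈^{em+k}| = |S| |P| + 2 |Q|, with |S| = 44 for e = 8 and |S| = 4 for e = 2.
module Submission where

open import Defs
open import Data.Nat using (ℕ; suc; _+_; _*_)
open import Relation.Binary.PropositionalEquality using (_≡_)

open import Algebra.Bundles using (CommutativeRing)
open import Algebra.Properties.CommutativeSemigroup using (interchange; xy∙z≈xz∙y)
open import Data.Bool using (Bool; true; false; _xor_; not; T)
open import Data.Bool.Properties using (xor-∧-commutativeRing; xor-assoc; xor-identityʳ)
open import Data.Bool.Solver using (module xor-∧-Solver)
open import Data.List using (List; []; _∷_; _++_; map; foldr; filter; cartesianProductWith; length)
open import Data.List.Properties using (map-∘; map-cong; map-id; length-++; length-map)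
open import Data.List.Membership.Propositional using (_∈_; _∉_)
open import Data.List.Membership.Propositional.Properties
  using (∈-filter⁺; ∈-filter⁻; ∈-map⁻; ∈-++⁺ˡ; ∈-++⁺ʳ; ∈-cartesianProductWith⁻)
open import Data.List.Membership.Propositional.Properties.WithK using (unique∧set⇒bag)
open import Data.List.Relation.Binary.BagAndSetEquality using (∼bag⇒↭)
open import Data.List.Relation.Binary.Disjoint.Propositional using (Disjoint)
open import Data.List.Relation.Binary.Permutation.Propositional using (_↭_; ↭⇒↭ₛ)
open import Data.List.Relation.Binary.Permutation.Propositional.Properties using (map⁺; ↭-length)
open import Data.List.Relation.Binary.Permutation.Setoid.Properties using (foldr-commMonoid)
open import Data.List.Relation.Unary.All using (All; []; _∷_)
import Data.List.Relation.Unary.All as All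
import Data.List.Relation.Unary.All.Properties as AllP
open import Data.List.Relation.Unary.Any using (here; there; tail)
open import Data.List.Relation.Unary.Unique.Propositional using (Unique; []; _∷_)
import Data.List.Relation.Unary.Unique.Propositional.Properties as UP
open import Data.Nat
  using (zero; _^_; _≡ᵇ_; _<_; _≤_; s≤s; NonZero; >-nonZero; ≢-nonZero; ≢-nonZero⁻¹)
open import Data.Nat.Coprimality using (Coprime; coprime-divisor; coprime-/gcd)
import Data.Nat.Coprimality as Coprime
open import Data.Nat.Divisibility using (_∣_; divides; ∣-trans; ∣1⇒≡1; ∣⇒≤)
open import Data.Nat.DivMod using (_/_; m/n*n≡m)
open import Data.Nat.GCD using (gcd; gcd[m,n]∣m; gcd[m,n]∣n; gcd[m,n]≢0)
open import Data.Nat.Properties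
  using ( _≟_; _<?_; ≡ᵇ⇒≡; ≡⇒≡ᵇ; suc-injective; +-identityʳ; +-suc; *-identityˡ; *-identityʳ
        ; *-comm; *-assoc; *-cancelˡ-≡; *-cancelʳ-≡; m*n≢0; ^-identityʳ; ^-zeroˡ; ^-*-assoc; m^n≢0
        ; ^-monoˡ-≤; ≰⇒>; <⇒≱; ≤-trans; n≢0⇒n>0; *-commutativeSemigroup )
open import Data.Nat.Solver using (module +-*-Solver)
open import Data.List.Membership.DecPropositional _≟_ using (_∈?_; _∉?_)
open import Data.List.Relation.Unary.Unique.DecPropositional _≟_ using (unique?)
open import Data.Product using (_×_; _,_; proj₁; proj₂)
open import Data.Sum using (_⊎_; inj₁; inj₂)
open import Function using (id; _∘_; _⇔_; mk⇔)
open import Level using (0ℓ)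
open import Relation.Binary.Bundles using (Setoid)
open import Relation.Binary.PropositionalEquality
  using (_≢_; refl; sym; trans; cong; cong₂; subst; setoid; module ≡-Reasoning)
import Relation.Binary.Reasoning.Setoid as SetoidReasoning
open import Relation.Nullary using (Dec; ¬?; yes; no; contradiction; _×-dec_)
open import Relation.Nullary.Decidable using (from-yes)
open import Relation.Unary using (Decidable)

private
  variable
    A B A′ B′ : List ℕ
    g h : ℕ → Bool
  module Xor = CommutativeRing xor-∧-commutativeRing

-- Sums in 𝔽₂

parity : (ℕ → Bool) → List ℕ → Bool
parity g = foldr _xor_ false ∘ map g

parity-++ : ∀ g A B → parity g (A ++ B) ≡ parity g A xor parity g B
parity-++ g []      B = refl
parity-++ g (a ∷ A) B = trans (cong (g a xor_) (parity-++ g A B)) (sym (xor-assoc (g a) _ _))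

parity-map : ∀ g f A → parity g (map f A) ≡ parity (g ∘ f) A
parity-map g f A = cong (foldr _xor_ false) (sym (map-∘ A))

parity-cong : (∀ a → g a ≡ h a) → ∀ A → parity g A ≡ parity h A
parity-cong g≗h []      = refl
parity-cong g≗h (a ∷ A) = cong₂ _xor_ (g≗h a) (parity-cong g≗h A)

parity-xor : ∀ g h A → parity (λ a → g a xor h a) A ≡ parity g A xor parity h A
parity-xor g h []      = refl
parity-xor g h (a ∷ A) = trans (cong ((g a xor h a) xor_) (parity-xor g h A))
  (interchange Xor.+-commutativeSemigroup (g a) (h a) (parity g A) (parity h A))

parity-↭ : ∀ g → A ↭ B → parity g A ≡ parity g B
parity-↭ g A↭B = foldr-commMonoid (setoid Bool) Xor.+-isCommutativeMonoid (↭⇒↭ₛ (map⁺ g A↭B))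

parity-partition : ∀ g {P : ℕ → Set} (P? : Decidable P) A →
                   parity g A ≡ parity g (filter (¬? ∘ P?) A) xor parity g (filter P? A)
parity-partition g P? []      = refl
parity-partition g P? (a ∷ A) with P? a
... | yes _ = trans (cong (g a xor_) (parity-partition g P? A))
                    (rotate (g a) (parity g (filter (¬? ∘ P?) A)) (parity g (filter P? A)))
  where
  open xor-∧-Solver
  rotate : ∀ x y z → x xor (y xor z) ≡ y xor (x xor z)
  rotate = solve 3 (λ x y z → x :+ (y :+ z) := y :+ (x :+ z)) refl
... | no _  = trans (cong (g a xor_) (parity-partition g P? A)) (sym (xor-assoc (g a) _ _))

-- Off-diagonal terms of a symmetric double sum come in equal pairs.
parity-diagonal : ∀ (h : ℕ → ℕ → Bool) → (∀ a b → h a b ≡ h b a) →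
                  ∀ A → parity (λ a → parity (h a) A) A ≡ parity (λ a → h a a) A
parity-diagonal h h-sym []      = refl
parity-diagonal h h-sym (p ∷ A) = begin
  (h p p xor X) xor parity (λ a → h a p xor parity (h a) A) A
    ≡⟨ cong ((h p p xor X) xor_) (parity-xor (λ a → h a p) (λ a → parity (h a) A) A) ⟩
  (h p p xor X) xor (parity (λ a → h a p) A xor Y)
    ≡⟨ cong (λ z → (h p p xor X) xor (z xor Y)) (parity-cong (λ a → h-sym a p) A) ⟩
  (h p p xor X) xor (X xor Y)
    ≡⟨ cancel (h p p) X Y ⟩
  h p p xor Y
    ≡⟨ cong (h p p xor_) (parity-diagonal h h-sym A) ⟩
  h p p xor parity (λ a → h a a) A ∎
  where
  open ≡-Reasoning
  open xor-∧-Solver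
  X = parity (h p) A
  Y = parity (λ a → parity (h a) A) A
  cancel : ∀ x y z → (x xor y) xor (y xor z) ≡ x xor z
  cancel = solve 3 (λ x y z → (x :+ y) :+ (y :+ z) := x :+ z) refl

parity-cartesianProductWith : ∀ (f : ℕ → ℕ → ℕ) g A B →
  parity g (cartesianProductWith f A B) ≡ parity (λ a → parity (λ b → g (f a b)) B) A
parity-cartesianProductWith f g []      B = refl
parity-cartesianProductWith f g (a ∷ A) B =
  trans (parity-++ g (map (f a) B) (cartesianProductWith f A B))
        (cong₂ _xor_ (parity-map g (f a) B) (parity-cartesianProductWith f g A B))

-- The group algebra 𝔽₂[ℕ]

-- A ≈₂ B: A and B are the same element of 𝔽₂[ℕ], i.e. every number occurs in them with the
-- same parity.  Testing against all g : ℕ → Bool makes every congruence below immediate.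
infix 4 _≈₂_

record _≈₂_ (A B : List ℕ) : Set where
  constructor mk≈₂
  field parity-≡ : ∀ g → parity g A ≡ parity g B

open _≈₂_

≈₂-setoid : Setoid 0ℓ 0ℓ
≈₂-setoid = record
  { Carrier       = List ℕ
  ; _≈_           = _≈₂_
  ; isEquivalence = record
    { refl  = mk≈₂ λ _ → refl
    ; sym   = λ A≈B → mk≈₂ λ g → sym (parity-≡ A≈B g)
    ; trans = λ A≈B B≈C → mk≈₂ λ g → trans (parity-≡ A≈B g) (parity-≡ B≈C g)
    }
  }

module ≈₂ = Setoid ≈₂-setoid

++-cong : A ≈₂ A′ → B ≈₂ B′ → A ++ B ≈₂ A′ ++ B′
++-cong {A} {A′} {B} {B′} A≈A′ B≈B′ = mk≈₂ λ g → begin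
  parity g (A ++ B)            ≡⟨ parity-++ g A B ⟩
  parity g A xor parity g B    ≡⟨ cong₂ _xor_ (parity-≡ A≈A′ g) (parity-≡ B≈B′ g) ⟩
  parity g A′ xor parity g B′  ≡⟨ parity-++ g A′ B′ ⟨
  parity g (A′ ++ B′)          ∎
  where open ≡-Reasoning

map-resp-≈₂ : ∀ f → A ≈₂ B → map f A ≈₂ map f B
map-resp-≈₂ {A} {B} f A≈B = mk≈₂ λ g → begin
  parity g (map f A)  ≡⟨ parity-map g f A ⟩
  parity (g ∘ f) A    ≡⟨ parity-≡ A≈B (g ∘ f) ⟩
  parity (g ∘ f) B    ≡⟨ parity-map g f B ⟨
  parity g (map f B)  ∎
  where open ≡-Reasoning

partition-≈₂ : ∀ {P : ℕ → Set} (P? : Decidable P) A → A ≈₂ filter (¬? ∘ P?) A ++ filter P? A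
partition-≈₂ P? A = mk≈₂ λ g →
  trans (parity-partition g P? A) (sym (parity-++ g (filter (¬? ∘ P?) A) (filter P? A)))

infixl 7 _⊗_

_⊗_ : List ℕ → List ℕ → List ℕ
_⊗_ = cartesianProductWith _*_

parity-⊗ : ∀ g A B → parity g (A ⊗ B) ≡ parity (λ a → parity (λ b → g (a * b)) B) A
parity-⊗ = parity-cartesianProductWith _*_

⊗-cong : A ≈₂ A′ → B ≈₂ B′ → A ⊗ B ≈₂ A′ ⊗ B′
⊗-cong {A} {A′} {B} {B′} A≈A′ B≈B′ = mk≈₂ λ g → begin
  parity g (A ⊗ B)                                ≡⟨ parity-⊗ g A B ⟩
  parity (λ a → parity (λ b → g (a * b)) B) A     ≡⟨ parity-cong (λ a → parity-≡ B≈B′ _) A ⟩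
  parity (λ a → parity (λ b → g (a * b)) B′) A    ≡⟨ parity-≡ A≈A′ _ ⟩
  parity (λ a → parity (λ b → g (a * b)) B′) A′   ≡⟨ parity-⊗ g A′ B′ ⟨
  parity g (A′ ⊗ B′)                              ∎
  where open ≡-Reasoning

⊗-assoc : ∀ A B C → A ⊗ B ⊗ C ≈₂ A ⊗ (B ⊗ C)
⊗-assoc A B C = mk≈₂ λ g → begin
  parity g (A ⊗ B ⊗ C)
    ≡⟨ parity-⊗ g (A ⊗ B) C ⟩
  parity (λ x → parity (λ c → g (x * c)) C) (A ⊗ B)
    ≡⟨ parity-⊗ _ A B ⟩
  parity (λ a → parity (λ b → parity (λ c → g (a * b * c)) C) B) A
    ≡⟨ parity-cong (λ a → parity-cong (λ b → parity-cong (λ c → cong g (*-assoc a b c)) C) B) A ⟩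
  parity (λ a → parity (λ b → parity (λ c → g (a * (b * c))) C) B) A
    ≡⟨ parity-cong (λ a → parity-⊗ (λ y → g (a * y)) B C) A ⟨
  parity (λ a → parity (λ y → g (a * y)) (B ⊗ C)) A
    ≡⟨ parity-⊗ g A (B ⊗ C) ⟨
  parity g (A ⊗ (B ⊗ C)) ∎
  where open ≡-Reasoning

⊗-identityʳ : ∀ A → A ⊗ (1 ∷ []) ≈₂ A
⊗-identityʳ A = mk≈₂ λ g → trans (parity-⊗ g A (1 ∷ []))
  (parity-cong (λ a → trans (xor-identityʳ _) (cong g (*-identityʳ a))) A)

⊗-distribˡ-++ : ∀ A B C → A ⊗ (B ++ C) ≈₂ A ⊗ B ++ A ⊗ C
⊗-distribˡ-++ A B C = mk≈₂ λ g → begin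
  parity g (A ⊗ (B ++ C))
    ≡⟨ parity-⊗ g A (B ++ C) ⟩
  parity (λ a → parity (λ x → g (a * x)) (B ++ C)) A
    ≡⟨ parity-cong (λ a → parity-++ _ B C) A ⟩
  parity (λ a → parity (λ b → g (a * b)) B xor parity (λ c → g (a * c)) C) A
    ≡⟨ parity-xor _ _ A ⟩
  parity (λ a → parity (λ b → g (a * b)) B) A xor parity (λ a → parity (λ c → g (a * c)) C) A
    ≡⟨ cong₂ _xor_ (parity-⊗ g A B) (parity-⊗ g A C) ⟨
  parity g (A ⊗ B) xor parity g (A ⊗ C)
    ≡⟨ parity-++ g (A ⊗ B) (A ⊗ C) ⟨
  parity g (A ⊗ B ++ A ⊗ C) ∎
  where open ≡-Reasoning

mapPow : ℕ → List ℕ → List ℕ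
mapPow e = map (_^ e)

^-distribʳ-* : ∀ m n e → (m * n) ^ e ≡ m ^ e * n ^ e
^-distribʳ-* m n zero    = refl
^-distribʳ-* m n (suc e) = trans (cong (m * n *_) (^-distribʳ-* m n e))
  (interchange *-commutativeSemigroup m n (m ^ e) (n ^ e))

mapPow-⊗ : ∀ e A B → mapPow e (A ⊗ B) ≈₂ mapPow e A ⊗ mapPow e B
mapPow-⊗ e A B = mk≈₂ λ g → begin
  parity g (mapPow e (A ⊗ B))
    ≡⟨ parity-map g (_^ e) (A ⊗ B) ⟩
  parity (λ x → g (x ^ e)) (A ⊗ B)
    ≡⟨ parity-⊗ _ A B ⟩
  parity (λ a → parity (λ b → g ((a * b) ^ e)) B) A
    ≡⟨ parity-cong (λ a → parity-cong (λ b → cong g (^-distribʳ-* a b e)) B) A ⟩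
  parity (λ a → parity (λ b → g (a ^ e * b ^ e)) B) A
    ≡⟨ parity-cong (λ a → parity-map (λ y → g (a ^ e * y)) (_^ e) B) A ⟨
  parity (λ a → parity (λ y → g (a ^ e * y)) (mapPow e B)) A
    ≡⟨ parity-map _ (_^ e) A ⟨
  parity (λ x → parity (λ y → g (x * y)) (mapPow e B)) (mapPow e A)
    ≡⟨ parity-⊗ g (mapPow e A) (mapPow e B) ⟨
  parity g (mapPow e A ⊗ mapPow e B) ∎
  where open ≡-Reasoning

mapPow-mapPow : ∀ d e A → mapPow d (mapPow e A) ≡ mapPow (e * d) A
mapPow-mapPow d e A = trans (sym (map-∘ A)) (map-cong (λ a → ^-*-assoc a e d) A)

⊗-self : ∀ A → A ⊗ A ≈₂ mapPow 2 A
⊗-self A = mk≈₂ λ g → begin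
  parity g (A ⊗ A)
    ≡⟨ parity-⊗ g A A ⟩
  parity (λ a → parity (λ b → g (a * b)) A) A
    ≡⟨ parity-diagonal (λ a b → g (a * b)) (λ a b → cong g (*-comm a b)) A ⟩
  parity (λ a → g (a * a)) A
    ≡⟨ parity-cong (λ a → cong (λ b → g (a * b)) (*-identityʳ a)) A ⟨
  parity (λ a → g (a ^ 2)) A
    ≡⟨ parity-map g (_^ 2) A ⟨
  parity g (mapPow 2 A) ∎
  where open ≡-Reasoning

powProducts : ℕ → List ℕ → List ℕ → List ℕ
powProducts e = cartesianProductWith (λ a b → a ^ e * b)

mapPow-⊗-≈₂ : ∀ e A B → mapPow e A ⊗ B ≈₂ powProducts e A B
mapPow-⊗-≈₂ e A B = mk≈₂ λ g → begin
  parity g (mapPow e A ⊗ B)                               ≡⟨ parity-⊗ g (mapPow e A) B ⟩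
  parity (λ x → parity (λ b → g (x * b)) B) (mapPow e A)  ≡⟨ parity-map _ (_^ e) A ⟩
  parity (λ a → parity (λ b → g (a ^ e * b)) B) A         ≡⟨ parity-cartesianProductWith _ g A B ⟨
  parity g (powProducts e A B)                            ∎
  where open ≡-Reasoning

mapPow-⊗-split : ∀ e P D S T → T ≈₂ S ++ mapPow e D ⊗ D →
                 mapPow e P ⊗ T ≈₂ mapPow e P ⊗ S ++ mapPow e (P ⊗ D) ⊗ D
mapPow-⊗-split e P D S T T≈ = begin
  Pᵉ ⊗ T                           ≈⟨ ⊗-cong (≈₂.refl {Pᵉ}) T≈ ⟩
  Pᵉ ⊗ (S ++ mapPow e D ⊗ D)       ≈⟨ ⊗-distribˡ-++ Pᵉ S (mapPow e D ⊗ D) ⟩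
  Pᵉ ⊗ S ++ Pᵉ ⊗ (mapPow e D ⊗ D)  ≈⟨ ++-cong (≈₂.refl {Pᵉ ⊗ S}) (⊗-assoc Pᵉ (mapPow e D) D) ⟨
  Pᵉ ⊗ S ++ Pᵉ ⊗ mapPow e D ⊗ D    ≈⟨ ++-cong (≈₂.refl {Pᵉ ⊗ S}) (⊗-cong (mapPow-⊗ e P D) ≈₂.refl) ⟨
  Pᵉ ⊗ S ++ mapPow e (P ⊗ D) ⊗ D   ∎
  where
  open SetoidReasoning ≈₂-setoid
  Pᵉ = mapPow e P

≡ᵇ-true⇒≡ : ∀ {m n} → (m ≡ᵇ n) ≡ true → m ≡ n
≡ᵇ-true⇒≡ {m} {n} m≡ᵇn = ≡ᵇ⇒≡ m n (subst T (sym m≡ᵇn) _)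

≡ᵇ-false⇒≢ : ∀ {m n} → (m ≡ᵇ n) ≡ false → m ≢ n
≡ᵇ-false⇒≢ {m} {n} m≢ᵇn m≡n = subst T m≢ᵇn (≡⇒≡ᵇ m n m≡n)

infix 5 _∈₂_

_∈₂_ : ℕ → List ℕ → Bool
x ∈₂ A = parity (x ≡ᵇ_) A

∉⇒∈₂≡false : ∀ {x} A → x ∉ A → x ∈₂ A ≡ false
∉⇒∈₂≡false     []      _  = refl
∉⇒∈₂≡false {x} (a ∷ A) x∉ with x ≡ᵇ a in x≡ᵇa
... | true  = contradiction (here (≡ᵇ-true⇒≡ x≡ᵇa)) x∉
... | false = ∉⇒∈₂≡false A (x∉ ∘ there)

∈⇒∈₂≡true : ∀ {x A} → Unique A → x ∈ A → x ∈₂ A ≡ true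
∈⇒∈₂≡true {x} {a ∷ A} u@(_ ∷ uA) x∈ with x ≡ᵇ a in x≡ᵇa
... | true  = cong not (∉⇒∈₂≡false {x} A
                (subst (_∉ A) (sym (≡ᵇ-true⇒≡ x≡ᵇa)) (UP.Unique[x∷xs]⇒x∉xs u)))
... | false = ∈⇒∈₂≡true uA (tail (≡ᵇ-false⇒≢ x≡ᵇa) x∈)

∈₂⇒∈ : ∀ {x} A → x ∈₂ A ≡ true → x ∈ A
∈₂⇒∈ {x} (a ∷ A) x∈₂ with x ≡ᵇ a in x≡ᵇa
... | true  = here (≡ᵇ-true⇒≡ x≡ᵇa)
... | false = there (∈₂⇒∈ A x∈₂)

unique-↭ : Unique A → Unique B → (∀ {x} → x ∈ A ⇔ x ∈ B) → A ↭ B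
unique-↭ uA uB A⇔B = ∼bag⇒↭ (unique∧set⇒bag uA uB A⇔B)

≈₂⇒↭ : Unique A → Unique B → A ≈₂ B → A ↭ B
≈₂⇒↭ uA uB A≈B = unique-↭ uA uB (mk⇔ (transport uA A≈B) (transport uB (≈₂.sym A≈B)))
  where
  transport : ∀ {A B x} → Unique A → A ≈₂ B → x ∈ A → x ∈ B
  transport {A} {B} uA A≈B x∈A = ∈₂⇒∈ B (trans (sym (parity-≡ A≈B _)) (∈⇒∈₂≡true uA x∈A))

-- Injectivity is only required on A, unlike UP.map⁺.
unique-map : ∀ (f : ℕ → ℕ) → Unique A → (∀ {a a′} → a ∈ A → a′ ∈ A → f a ≡ f a′ → a ≡ a′) →
             Unique (map f A)
unique-map f []         inj = []
unique-map f (a∉A ∷ uA) inj =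
  AllP.map⁺ (All.tabulate λ a′∈A fa≡fa′ → All.lookup a∉A a′∈A (inj (here refl) (there a′∈A) fa≡fa′))
  ∷ unique-map f uA (λ a∈A a′∈A → inj (there a∈A) (there a′∈A))

unique-cartesianProductWith : ∀ (f : ℕ → ℕ → ℕ) → Unique A → Unique B →
  (∀ {a a′ b b′} → a ∈ A → a′ ∈ A → b ∈ B → b′ ∈ B → f a b ≡ f a′ b′ → a ≡ a′ × b ≡ b′) →
  Unique (cartesianProductWith f A B)
unique-cartesianProductWith f []                     uB inj = []
unique-cartesianProductWith {a ∷ A} {B} f (a∉A ∷ uA) uB inj = UP.++⁺
  (unique-map (f a) uB (λ b∈B b′∈B → proj₂ ∘ inj (here refl) (here refl) b∈B b′∈B))
  (unique-cartesianProductWith f uA uB (λ a∈A a′∈A → inj (there a∈A) (there a′∈A)))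
  disjoint
  where
  disjoint : Disjoint (map (f a) B) (cartesianProductWith f A B)
  disjoint (v∈map , v∈prod) with ∈-map⁻ (f a) v∈map | ∈-cartesianProductWith⁻ f A B v∈prod
  ... | b , b∈B , refl | a′ , b′ , a′∈A , b′∈B , fab≡fa′b′ =
    All.lookup a∉A a′∈A (proj₁ (inj (here refl) (there a′∈A) b∈B b′∈B fab≡fa′b′))

unique-++⁻ : ∀ A → Unique (A ++ B) → Unique A × Unique B × Disjoint A B
unique-++⁻ []      uB         = [] , uB , λ ()
unique-++⁻ (a ∷ A) (a∉ ∷ uAB) with unique-++⁻ A uAB | AllP.++⁻ A a∉
... | uA , uB , A#B | a∉A , a∉B = a∉A ∷ uA , uB , λ where
  (here refl , a∈B) → All.lookup a∉B a∈B refl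
  (there v∈A , v∈B) → A#B (v∈A , v∈B)

length-cartesianProductWith : ∀ (f : ℕ → ℕ → ℕ) A B →
                              length (cartesianProductWith f A B) ≡ length A * length B
length-cartesianProductWith f []      B = refl
length-cartesianProductWith f (a ∷ A) B = trans (length-++ (map (f a) B))
  (cong₂ _+_ (length-map (f a) B) (length-cartesianProductWith f A B))

△-≈₂-++ : Unique A → Unique B → A △ B ≈₂ A ++ B
△-≈₂-++ {A} {B} uA uB = mk≈₂ λ g → begin
  parity g (A △ B)
    ≡⟨ parity-++ g A∖B B∖A ⟩
  parity g A∖B xor parity g B∖A
    ≡⟨ cancel (parity g A∖B) (parity g B∖A) (parity g A∩B) ⟨
  (parity g A∖B xor parity g A∩B) xor (parity g B∖A xor parity g A∩B)
    ≡⟨ cong (λ i → (parity g A∖B xor parity g A∩B) xor (parity g B∖A xor i)) (parity-↭ g A∩B↭B∩A) ⟩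
  (parity g A∖B xor parity g A∩B) xor (parity g B∖A xor parity g B∩A)
    ≡⟨ cong₂ _xor_ (parity-partition g (_∈? B) A) (parity-partition g (_∈? A) B) ⟨
  parity g A xor parity g B
    ≡⟨ parity-++ g A B ⟨
  parity g (A ++ B) ∎
  where
  open ≡-Reasoning
  open xor-∧-Solver
  A∖B = filter (_∉? B) A
  B∖A = filter (_∉? A) B
  A∩B = filter (_∈? B) A
  B∩A = filter (_∈? A) B
  cancel : ∀ x y z → (x xor z) xor (y xor z) ≡ x xor y
  cancel = solve 3 (λ x y z → (x :+ z) :+ (y :+ z) := x :+ y) refl
  ∩-comm : ∀ {A B x} → x ∈ filter (_∈? B) A → x ∈ filter (_∈? A) B
  ∩-comm {A} {B} x∈ = let x∈A , x∈B = ∈-filter⁻ (_∈? B) {xs = A} x∈ in ∈-filter⁺ (_∈? A) x∈B x∈A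
  A∩B↭B∩A : A∩B ↭ B∩A
  A∩B↭B∩A = unique-↭ (UP.filter⁺ (_∈? B) uA) (UP.filter⁺ (_∈? A) uB)
                     (mk⇔ (∩-comm {A} {B}) (∩-comm {B} {A}))

△-unique : Unique A → Unique B → Unique (A △ B)
△-unique {A} {B} uA uB = UP.++⁺ (UP.filter⁺ (_∉? B) uA) (UP.filter⁺ (_∉? A) uB) disjoint
  where
  disjoint : Disjoint (filter (_∉? B) A) (filter (_∉? A) B)
  disjoint (x∈A∖B , x∈B∖A) =
    proj₂ (∈-filter⁻ (_∉? A) {xs = B} x∈B∖A) (proj₁ (∈-filter⁻ (_∉? B) {xs = A} x∈A∖B))

△-all : ∀ {P : ℕ → Set} → All P A → All P B → All P (A △ B)
△-all {A} {B} pA pB = AllP.++⁺ (AllP.filter⁺ (_∉? B) pA) (AllP.filter⁺ (_∉? A) pB)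

scale-unique : ∀ c .{{_ : NonZero c}} → Unique B → Unique (scale c B)
scale-unique c = UP.map⁺ (*-cancelˡ-≡ _ _ c)

scale-nonZero : ∀ c .{{_ : NonZero c}} → All NonZero B → All NonZero (scale c B)
scale-nonZero c {{c≢0}} = AllP.map⁺ ∘ All.map (λ {b} b≢0 → m*n≢0 c b {{c≢0}} {{b≢0}})

∇-unique : ∀ C → All NonZero C → Unique B → Unique (C ∇ B)
∇-unique []      []         uB = []
∇-unique (c ∷ C) (nz ∷ nzs) uB = △-unique (scale-unique c {{nz}} uB) (∇-unique C nzs uB)

∇-nonZero : ∀ C → All NonZero C → All NonZero B → All NonZero (C ∇ B)
∇-nonZero []      []         nzB = []
∇-nonZero (c ∷ C) (nz ∷ nzs) nzB = △-all (scale-nonZero c {{nz}} nzB) (∇-nonZero C nzs nzB)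

∇-≈₂-⊗ : ∀ C → All NonZero C → Unique B → C ∇ B ≈₂ C ⊗ B
∇-≈₂-⊗ []      []         uB = ≈₂.refl
∇-≈₂-⊗ (c ∷ C) (nz ∷ nzs) uB = ≈₂.trans
  (△-≈₂-++ (scale-unique c {{nz}} uB) (∇-unique C nzs uB))
  (++-cong ≈₂.refl (∇-≈₂-⊗ C nzs uB))

-- Powers of H₈

H8-nonZero : All NonZero H8
H8-nonZero = All.tabulate λ x∈H8 → let _ , _ , x≡1+i = ∈-map⁻ suc x∈H8 in subst NonZero (sym x≡1+i) _

H8-unique : Unique H8
H8-unique = UP.map⁺ suc-injective (UP.upTo⁺ 8)

H8pow-nonZero : ∀ k → All NonZero (H8pow k)
H8pow-nonZero zero    = _ ∷ []
H8pow-nonZero (suc k) = ∇-nonZero (H8pow k) (H8pow-nonZero k) H8-nonZero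

H8pow-unique : ∀ k → Unique (H8pow k)
H8pow-unique zero    = [] ∷ []
H8pow-unique (suc k) = ∇-unique (H8pow k) (H8pow-nonZero k) H8-unique

H8pow-suc : ∀ k → H8pow (suc k) ≈₂ H8pow k ⊗ H8
H8pow-suc k = ∇-≈₂-⊗ (H8pow k) (H8pow-nonZero k) H8-unique

H8pow-+ : ∀ a b → H8pow (a + b) ≈₂ H8pow a ⊗ H8pow b
H8pow-+ a zero    = begin
  H8pow (a + 0)      ≡⟨ cong H8pow (+-identityʳ a) ⟩
  H8pow a            ≈⟨ ⊗-identityʳ (H8pow a) ⟨
  H8pow a ⊗ H8pow 0  ∎
  where open SetoidReasoning ≈₂-setoid
H8pow-+ a (suc b) = begin
  H8pow (a + suc b)         ≡⟨ cong H8pow (+-suc a b) ⟩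
  H8pow (suc (a + b))       ≈⟨ H8pow-suc (a + b) ⟩
  H8pow (a + b) ⊗ H8        ≈⟨ ⊗-cong (H8pow-+ a b) ≈₂.refl ⟩
  H8pow a ⊗ H8pow b ⊗ H8    ≈⟨ ⊗-assoc (H8pow a) (H8pow b) H8 ⟩
  H8pow a ⊗ (H8pow b ⊗ H8)  ≈⟨ ⊗-cong (≈₂.refl {H8pow a}) (H8pow-suc b) ⟨
  H8pow a ⊗ H8pow (suc b)   ∎
  where open SetoidReasoning ≈₂-setoid

H8pow-2* : ∀ n → H8pow (2 * n) ≈₂ mapPow 2 (H8pow n)
H8pow-2* n = begin
  H8pow (n + (n + 0))      ≈⟨ H8pow-+ n (n + 0) ⟩
  H8pow n ⊗ H8pow (n + 0)  ≡⟨ cong (λ k → H8pow n ⊗ H8pow k) (+-identityʳ n) ⟩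
  H8pow n ⊗ H8pow n        ≈⟨ ⊗-self (H8pow n) ⟩
  mapPow 2 (H8pow n)       ∎
  where open SetoidReasoning ≈₂-setoid

H8pow-2^* : ∀ j n → H8pow (2 ^ j * n) ≈₂ mapPow (2 ^ j) (H8pow n)
H8pow-2^* zero    n = begin
  H8pow (n + 0)       ≡⟨ cong H8pow (+-identityʳ n) ⟩
  H8pow n             ≡⟨ map-id (H8pow n) ⟨
  map id (H8pow n)    ≡⟨ map-cong {f = _^ 1} {g = id} ^-identityʳ (H8pow n) ⟨
  mapPow 1 (H8pow n)  ∎
  where open SetoidReasoning ≈₂-setoid
H8pow-2^* (suc j) n = begin
  H8pow (2 * 2 ^ j * n)                ≡⟨ cong H8pow (*-assoc 2 (2 ^ j) n) ⟩
  H8pow (2 * (2 ^ j * n))              ≈⟨ H8pow-2* (2 ^ j * n) ⟩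
  mapPow 2 (H8pow (2 ^ j * n))         ≈⟨ map-resp-≈₂ (_^ 2) (H8pow-2^* j n) ⟩
  mapPow 2 (mapPow (2 ^ j) (H8pow n))  ≡⟨ mapPow-mapPow 2 (2 ^ j) (H8pow n) ⟩
  mapPow (2 ^ j * 2) (H8pow n)         ≡⟨ cong (λ e → mapPow e (H8pow n)) (*-comm (2 ^ j) 2) ⟩
  mapPow (2 * 2 ^ j) (H8pow n)         ∎
  where open SetoidReasoning ≈₂-setoid

special : ℕ → List ℕ
special e = mapPow e (1 ∷ 2 ∷ []) ⊗ (1 ∷ 2 ∷ [])

-- The set S in H₈^k = S + {1, 2ᵉ} · {1, 2}.
cofactor : ℕ → ℕ → List ℕ
cofactor e k = filter (_∉? special e) (H8pow k)

unique-1∷2 : Unique (1 ∷ 2 ∷ [])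
unique-1∷2 = ((λ ()) ∷ []) ∷ [] ∷ []

H8pow-split : ∀ j n k → filter (_∈? special (2 ^ j)) (H8pow k) ≡ special (2 ^ j) →
  H8pow (2 ^ j * n + k) ≈₂
    powProducts (2 ^ j) (H8pow n) (cofactor (2 ^ j) k)
    ++ powProducts (2 ^ j) (H8pow n ∇ (1 ∷ 2 ∷ [])) (1 ∷ 2 ∷ [])
H8pow-split j n k special⊆ = begin
  H8pow (e * n + k)                       ≈⟨ H8pow-+ (e * n) k ⟩
  H8pow (e * n) ⊗ H8pow k                 ≈⟨ ⊗-cong (H8pow-2^* j n) (≈₂.refl {H8pow k}) ⟩
  mapPow e P ⊗ H8pow k                    ≈⟨ mapPow-⊗-split e P D S (H8pow k) H8pow-k≈ ⟩
  mapPow e P ⊗ S ++ mapPow e (P ⊗ D) ⊗ D  ≈⟨ ++-cong (≈₂.refl {mapPow e P ⊗ S}) Qᵉ⊗D≈ ⟨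
  mapPow e P ⊗ S ++ mapPow e (P ∇ D) ⊗ D  ≈⟨ ++-cong (mapPow-⊗-≈₂ e P S) (mapPow-⊗-≈₂ e (P ∇ D) D) ⟩
  powProducts e P S ++ powProducts e (P ∇ D) D  ∎
  where
  open SetoidReasoning ≈₂-setoid
  e = 2 ^ j
  P = H8pow n
  D = 1 ∷ 2 ∷ []
  S = cofactor e k
  H8pow-k≈ : H8pow k ≈₂ S ++ special e
  H8pow-k≈ = subst (λ X → H8pow k ≈₂ S ++ X) special⊆ (partition-≈₂ (_∈? special e) (H8pow k))
  Qᵉ⊗D≈ : mapPow e (P ∇ D) ⊗ D ≈₂ mapPow e (P ⊗ D) ⊗ D
  Qᵉ⊗D≈ = ⊗-cong (map-resp-≈₂ (_^ e) (∇-≈₂-⊗ P (H8pow-nonZero n) unique-1∷2)) (≈₂.refl {D})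

-- Distinctness of the products yᵉ q

Separated : ℕ → ℕ → ℕ → Set
Separated e q q′ = 0 < q × q < 3 ^ e × q ≢ 2 ^ e * q′

coprime-* : ∀ {a m n} → Coprime a m → Coprime a n → Coprime a (m * n)
coprime-* {a} {m} a⊥m a⊥n {d} (d∣a , d∣mn) = a⊥n (d∣a , coprime-divisor d⊥m d∣mn)
  where
  d⊥m : Coprime d m
  d⊥m (i∣d , i∣m) = a⊥m (∣-trans i∣d d∣a , i∣m)

coprime-^ʳ : ∀ {a b} e → Coprime a b → Coprime a (b ^ e)
coprime-^ʳ zero    _   (_ , d∣1) = ∣1⇒≡1 d∣1
coprime-^ʳ (suc e) a⊥b = coprime-* a⊥b (coprime-^ʳ e a⊥b)

coprime-^ : ∀ {a b} e → Coprime a b → Coprime (a ^ e) (b ^ e)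
coprime-^ e a⊥b = Coprime.sym (coprime-^ʳ e (Coprime.sym (coprime-^ʳ e a⊥b)))

coprime-base<3 : ∀ e {a b q q′} → Coprime a b → 0 < q′ → q′ < 3 ^ e → a ^ e * q ≡ b ^ e * q′ → a < 3
coprime-base<3 e {a} {b} {q} {q′} a⊥b 0<q′ q′<3^e eq =
  ≰⇒> λ 3≤a → <⇒≱ q′<3^e (≤-trans (^-monoˡ-≤ e 3≤a) a^e≤q′)
  where
  a^e∣q′ : a ^ e ∣ q′
  a^e∣q′ = coprime-divisor (coprime-^ e a⊥b) (divides q (trans (sym eq) (*-comm (a ^ e) q)))
  a^e≤q′ : a ^ e ≤ q′
  a^e≤q′ = ∣⇒≤ {{>-nonZero 0<q′}} a^e∣q′

1-or-2 : ∀ {a} → 0 < a → a < 3 → a ≡ 1 ⊎ a ≡ 2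
1-or-2 {1}                 _ _                    = inj₁ refl
1-or-2 {2}                 _ _                    = inj₂ refl
1-or-2 {suc (suc (suc _))} _ (s≤s (s≤s (s≤s ())))

1^m*n≡n : ∀ m n → 1 ^ m * n ≡ n
1^m*n≡n m n = trans (cong (_* n) (^-zeroˡ m)) (*-identityˡ n)

coprime-pow-scale-injective : ∀ e {a b q q′} → 0 < a → 0 < b → Coprime a b →
  Separated e q q′ → Separated e q′ q → a ^ e * q ≡ b ^ e * q′ → a ≡ b × q ≡ q′
coprime-pow-scale-injective e {a} {b} {q} {q′} 0<a 0<b a⊥b sep sep′ eq
  with 1-or-2 0<a (coprime-base<3 e a⊥b (proj₁ sep′) (proj₁ (proj₂ sep′)) eq)
     | 1-or-2 0<b (coprime-base<3 e (Coprime.sym a⊥b) (proj₁ sep) (proj₁ (proj₂ sep)) (sym eq))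
... | inj₁ refl | inj₁ refl = refl , *-cancelˡ-≡ q q′ (1 ^ e) {{m^n≢0 1 e}} eq
... | inj₂ refl | inj₂ refl = refl , *-cancelˡ-≡ q q′ (2 ^ e) {{m^n≢0 2 e}} eq
... | inj₁ refl | inj₂ refl = contradiction (trans (sym (1^m*n≡n e q)) eq) (proj₂ (proj₂ sep))
... | inj₂ refl | inj₁ refl = contradiction (trans (sym (1^m*n≡n e q′)) (sym eq)) (proj₂ (proj₂ sep′))

pow-scale-injective : ∀ e {y z q q′} → .{{NonZero y}} → .{{NonZero z}} →
  Separated e q q′ → Separated e q′ q → y ^ e * q ≡ z ^ e * q′ → y ≡ z × q ≡ q′
pow-scale-injective e {y} {z} {q} {q′} sep sep′ eq =
  trans (sym ad≡y) (trans (cong (_* d) a≡b) bd≡z) , q≡q′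
  where
  d = gcd y z
  instance
    d≢0 : NonZero d
    d≢0 = ≢-nonZero (gcd[m,n]≢0 y z (inj₁ (≢-nonZero⁻¹ y)))
  a = y / d
  b = z / d
  ad≡y : a * d ≡ y
  ad≡y = m/n*n≡m (gcd[m,n]∣m y z)
  bd≡z : b * d ≡ z
  bd≡z = m/n*n≡m (gcd[m,n]∣n y z)
  positive : ∀ {c x} → .{{NonZero x}} → c * d ≡ x → 0 < c
  positive {x = x} cd≡x = n≢0⇒n>0 λ c≡0 → ≢-nonZero⁻¹ x (trans (sym cd≡x) (cong (_* d) c≡0))
  rearrange : ∀ c r → (c * d) ^ e * r ≡ c ^ e * r * d ^ e
  rearrange c r = trans (cong (_* r) (^-distribʳ-* c d e))
                        (xy∙z≈xz∙y *-commutativeSemigroup (c ^ e) (d ^ e) r)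
  eq′ : a ^ e * q ≡ b ^ e * q′
  eq′ = *-cancelʳ-≡ _ _ (d ^ e) {{m^n≢0 d e}} (begin
    a ^ e * q * d ^ e   ≡⟨ rearrange a q ⟨
    (a * d) ^ e * q     ≡⟨ cong (λ w → w ^ e * q) ad≡y ⟩
    y ^ e * q           ≡⟨ eq ⟩
    z ^ e * q′          ≡⟨ cong (λ w → w ^ e * q′) bd≡z ⟨
    (b * d) ^ e * q′    ≡⟨ rearrange b q′ ⟩
    b ^ e * q′ * d ^ e  ∎)
    where open ≡-Reasoning
  a≡b,q≡q′ = coprime-pow-scale-injective e (positive ad≡y) (positive bd≡z) (coprime-/gcd y z) sep sep′ eq′
  a≡b = proj₁ a≡b,q≡q′
  q≡q′ = proj₂ a≡b,q≡q′

Admissible : ℕ → List ℕ → Set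
Admissible e D = All (λ q → All (Separated e q) D) D

admissible? : ∀ e D → Dec (Admissible e D)
admissible? e D =
  All.all? (λ q → All.all? (λ q′ → 0 <? q ×-dec q <? 3 ^ e ×-dec ¬? (q ≟ 2 ^ e * q′)) D) D

decomposition-unique : ∀ e {P Q} S → All NonZero P → All NonZero Q → Unique P → Unique Q →
  Unique (S ++ 1 ∷ 2 ∷ []) → Admissible e (S ++ 1 ∷ 2 ∷ []) →
  Unique (powProducts e P S ++ powProducts e Q (1 ∷ 2 ∷ []))
decomposition-unique e {P} {Q} S nzP nzQ uP uQ uD adm = UP.++⁺
  (unique-cartesianProductWith _ uP uS λ y∈P z∈P q∈S q′∈S →
    injective nzP nzP y∈P z∈P (∈-++⁺ˡ q∈S) (∈-++⁺ˡ q′∈S))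
  (unique-cartesianProductWith _ uQ u12 λ y∈Q z∈Q q∈12 q′∈12 →
    injective nzQ nzQ y∈Q z∈Q (∈-++⁺ʳ S q∈12) (∈-++⁺ʳ S q′∈12))
  disjoint
  where
  D = S ++ 1 ∷ 2 ∷ []
  uS,u12,S#12 = unique-++⁻ S uD
  uS = proj₁ uS,u12,S#12
  u12 = proj₁ (proj₂ uS,u12,S#12)
  S#12 = proj₂ (proj₂ uS,u12,S#12)
  injective : ∀ {R R′ y z q q′} → All NonZero R → All NonZero R′ → y ∈ R → z ∈ R′ → q ∈ D → q′ ∈ D →
              y ^ e * q ≡ z ^ e * q′ → y ≡ z × q ≡ q′
  injective nzR nzR′ y∈R z∈R′ q∈D q′∈D =
    pow-scale-injective e {{All.lookup nzR y∈R}} {{All.lookup nzR′ z∈R′}}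
      (All.lookup (All.lookup adm q∈D) q′∈D) (All.lookup (All.lookup adm q′∈D) q∈D)
  disjoint : Disjoint (powProducts e P S) (powProducts e Q (1 ∷ 2 ∷ []))
  disjoint (v∈PS , v∈Q12)
    with ∈-cartesianProductWith⁻ _ P S v∈PS | ∈-cartesianProductWith⁻ _ Q (1 ∷ 2 ∷ []) v∈Q12
  ... | y , q , y∈P , q∈S , refl | z , q′ , z∈Q , q′∈12 , eq = S#12 (q∈S , subst (_∈ 1 ∷ 2 ∷ [])
    (sym (proj₂ (injective nzP nzQ y∈P z∈Q (∈-++⁺ˡ q∈S) (∈-++⁺ʳ S q′∈12) eq))) q′∈12)

card-split : ∀ j n k → filter (_∈? special (2 ^ j)) (H8pow k) ≡ special (2 ^ j) →
  Unique (cofactor (2 ^ j) k ++ 1 ∷ 2 ∷ []) → Admissible (2 ^ j) (cofactor (2 ^ j) k ++ 1 ∷ 2 ∷ []) →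
  card (2 ^ j * n + k) ≡ card n * length (cofactor (2 ^ j) k) + length (H8pow n ∇ (1 ∷ 2 ∷ [])) * 2
card-split j n k special⊆ uD adm = begin
  card (e * n + k)
    ≡⟨ ↭-length (≈₂⇒↭ (H8pow-unique (e * n + k)) unique-L (H8pow-split j n k special⊆)) ⟩
  length (powProducts e P S ++ powProducts e Q D)
    ≡⟨ length-++ (powProducts e P S) ⟩
  length (powProducts e P S) + length (powProducts e Q D)
    ≡⟨ cong₂ _+_ (length-cartesianProductWith _ P S) (length-cartesianProductWith _ Q D) ⟩
  card n * length S + length Q * 2 ∎
  where
  open ≡-Reasoning
  e = 2 ^ j
  P = H8pow n
  D = 1 ∷ 2 ∷ []
  Q = P ∇ D
  S = cofactor e k
  unique-L : Unique (powProducts e P S ++ powProducts e Q D)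
  unique-L = decomposition-unique e S (H8pow-nonZero n) (∇-nonZero P (H8pow-nonZero n) (_ ∷ _ ∷ []))
    (H8pow-unique n) (∇-unique P (H8pow-nonZero n) unique-1∷2) uD adm

-- The side conditions, and |cofactor 8 3| = 44 and |cofactor 2 1| = 4, are checked by evaluation.
lemma12 : (m : ℕ) → card (8 * suc m + 3) ≡ card (2 * suc m + 1) + 40 * card (suc m)
lemma12 m = begin
  card (8 * suc m + 3)
    ≡⟨ card-split 3 (suc m) 3 refl (from-yes (unique? D₈)) (from-yes (admissible? 8 D₈)) ⟩
  card (suc m) * 44 + length Q * 2
    ≡⟨ arithmetic (card (suc m)) (length Q) ⟩
  card (suc m) * 4 + length Q * 2 + 40 * card (suc m)
    ≡⟨ cong (_+ 40 * card (suc m))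
            (card-split 1 (suc m) 1 refl (from-yes (unique? D₂)) (from-yes (admissible? 2 D₂))) ⟨
  card (2 * suc m + 1) + 40 * card (suc m) ∎
  where
  open ≡-Reasoning
  open +-*-Solver
  Q = H8pow (suc m) ∇ (1 ∷ 2 ∷ [])
  D₈ = cofactor 8 3 ++ 1 ∷ 2 ∷ []
  D₂ = cofactor 2 1 ++ 1 ∷ 2 ∷ []
  arithmetic : ∀ p r → p * 44 + r * 2 ≡ p * 4 + r * 2 + 40 * p
  arithmetic = solve 2
    (λ p r → p :* con 44 :+ r :* con 2 := p :* con 4 :+ r :* con 2 :+ con 40 :* p) refl
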